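{- Let $p<q$ be prime numbers, $N=pq$, and let $i,s$ be the integers with $q=ip+s$ and $s\in\{1,\ldots,p-1\}$. If $q>2p$ and $q-p+1\notin\mathbb{Z}\text{ - }\mathcal{KS}(N)$, then $$\mathbb{Z}\text{ - }\mathcal{KS}(N)\subseteq\{ip,\,(i+1)p,\,p+q-1\}.$$
   Context: For a rational number $\alpha\neq 0$ write $\alpha=\frac{\alpha_1}{\alpha_2}$ with $\alpha_1,\alpha_2$ integers and $\gcd(\alpha_1,\alpha_2)=1$. An integer $N\ge 2$ is called an $\alpha$-Korselt number if $N\neq\alpha$ and $\alpha_2 r-\alpha_1$ divides $\alpha_2 N-\alpha_1$ (in $\mathbb{Z}$; $0$ divides only $0$) for every prime divisor $r$ of $N$. For a subset $\mathbb{A}\subseteq\mathbb{Q}$, $\mathbb{A}\text{ - }\mathcal{KS}(N)$ denotes the set of all $\beta\in\mathbb{A}\setminus\{0,N\}$ such that $N$ is a $\beta$-Korselt number. -}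

module Defs where

open import Data.Nat using (ℕ; _≤_)
open import Data.Nat.Primality using (Prime)
import Data.Nat.Divisibility as ℕD
open import Data.Integer using (ℤ; +_; _-_; 0ℤ)
open import Data.Integer.Divisibility using (_∣_)
open import Data.Product using (_×_)
open import Relation.Binary.PropositionalEquality using (_≢_)

-- For an INTEGER α we have α = α₁/α₂ with α₁ = α, α₂ = 1, so the paper's
-- condition "α₂ r - α₁ ∣ α₂ N - α₁" becomes "r - α ∣ N - α" (divisibility in ℤ;
-- stdlib's ℤ-divisibility has 0 ∣ n only for n = 0).
IsKorselt : ℤ → ℕ → Set
IsKorselt α N =
  (2 ≤ N) × (+ N ≢ α) ×
  (∀ (r : ℕ) → Prime r → r ℕD.∣ N → (+ r - α) ∣ (+ N - α))

InZKS : ℕ → ℤ → Set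
InZKS N β = (β ≢ 0ℤ) × (β ≢ + N) × IsKorselt β N

module Submission where

-- Let p < q be primes with 2p < q, N = pq and q = ip + s with 0 < s < p.  Writing
-- N = r + (N − r), the Korselt condition r − β ∣ N − β at a prime r ∣ N is equivalent to
-- |r − β| ∣ N − r, i.e. |p − β| ∣ p(q − 1) and |q − β| ∣ q(p − 1).  The proof is a case
-- analysis on the position of a Korselt base β:
--   • β < 0, 0 < β ≤ p and β = q are impossible (size and coprimality arguments);
--   • p < β < q forces β = ip, or β = q − p + 1, or m ∣ 2(p − 1) for m = q + 1 − 2p, and
--     in the last case q − p + 1 is itself a Korselt base of N;
--   • q < β ≠ N forces β = (i + 1)p or β = p + q − 1.
-- As q − p + 1 is not a Korselt base by hypothesis, only the three listed values remain.

open import Defs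
open import Data.Nat using (ℕ; zero; suc; _*_; _+_; _<_; _≤_; _≤?_; z≤n; s≤s; s≤s⁻¹; NonZero; >-nonZero)
open import Data.Nat.Properties
open import Data.Nat.Divisibility using (divides; ∣⇒≤; ∣-refl; ∣-trans; ∣m+n∣m⇒∣n; ∣m∣n⇒∣m+n; m∣m*n; n∣m*n; _∣?_; 0∣⇒≡0)
  renaming (_∣_ to _∣ℕ_)
open import Data.Nat.DivMod using (_/_; m*n/n≡m; m<n⇒m/n≡0; +-distrib-/-∣ˡ)
open import Data.Nat.Primality using (Prime; euclidsLemma; prime⇒irreducible; ¬prime[0]; ¬prime[1])
open import Data.Nat.Coprimality using (Coprime; coprime-divisor)
open import Data.Nat.Tactic.RingSolver using (solve-∀)
open import Data.Integer using (ℤ; +_; -[1+_]; _-_; ∣_∣; 0ℤ)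
import Data.Integer as ℤ
import Data.Integer.Properties as ℤP
import Data.Integer.Divisibility.Signed as Signed
import Data.Integer.Tactic.RingSolver as ℤSolver
open import Data.Integer.Divisibility using (_∣_)
open import Data.Sum using (_⊎_; inj₁; inj₂; map)
open import Data.Product using (_×_; _,_; ∃; proj₁; proj₂)
open import Data.Empty using (⊥; ⊥-elim)
open import Relation.Nullary using (¬_; Dec; yes; no)
open import Relation.Binary.PropositionalEquality
open import Relation.Binary.Definitions using (tri<; tri≈; tri>)
open import Function using (_∘_)

divisor≤ : ∀ {d n} → 1 ≤ n → d ∣ℕ n → d ≤ n
divisor≤ 1≤n = ∣⇒≤ {{>-nonZero 1≤n}}

0∤positive : ∀ {n} → 1 ≤ n → ¬ 0 ∣ℕ n
0∤positive 1≤n 0∣n = <-irrefl (sym (0∣⇒≡0 0∣n)) 1≤n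

gap : ∀ {m n} → m < n → ∃ λ d → m + suc d ≡ n
gap {m} m<n with d , m+1+d≡n ← m≤n⇒∃[o]m+o≡n m<n = d , trans (+-suc m d) m+1+d≡n

prime≥2 : ∀ {p} → Prime p → 2 ≤ p
prime≥2 {zero} p-prime = ⊥-elim (¬prime[0] p-prime)
prime≥2 {1} p-prime = ⊥-elim (¬prime[1] p-prime)
prime≥2 {suc (suc _)} _ = s≤s (s≤s z≤n)

prime-divides-prime : ∀ {r a} → Prime r → Prime a → r ∣ℕ a → r ≡ a
prime-divides-prime r-prime a-prime r∣a with prime⇒irreducible a-prime r∣a
... | inj₁ refl = ⊥-elim (¬prime[1] r-prime)
... | inj₂ r≡a = r≡a

prime-free-divisor : ∀ {r d m} → Prime r → ¬ r ∣ℕ d → d ∣ℕ r * m → d ∣ℕ m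
prime-free-divisor {r} {d} r-prime r∤d = coprime-divisor d⊥r
  where
  d⊥r : Coprime d r
  d⊥r (k∣d , k∣r) with prime⇒irreducible r-prime k∣r
  ... | inj₁ k≡1 = k≡1
  ... | inj₂ refl = ⊥-elim (r∤d k∣d)

distinct-prime-divisor : ∀ {a b u} → Prime a → Prime b → a ≢ b → a ∣ℕ b * u → a ∣ℕ u
distinct-prime-divisor {a} {b} {u} a-prime b-prime a≢b a∣bu with euclidsLemma b u a-prime a∣bu
... | inj₁ a∣b = ⊥-elim (a≢b (prime-divides-prime a-prime b-prime a∣b))
... | inj₂ a∣u = a∣u

prime-divisor-of-product : ∀ {p q r} → Prime p → Prime q → Prime r → r ∣ℕ p * q → r ≡ p ⊎ r ≡ q
prime-divisor-of-product {p} {q} p-prime q-prime r-prime r∣pq with euclidsLemma p q r-prime r∣pq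
... | inj₁ r∣p = inj₁ (prime-divides-prime r-prime p-prime r∣p)
... | inj₂ r∣q = inj₂ (prime-divides-prime r-prime q-prime r∣q)

common-multiple≥ : ∀ {p q n} → Prime p → Prime q → p ≢ q → 1 ≤ n → p ∣ℕ n → q ∣ℕ n → p * q ≤ n
common-multiple≥ {p} {q} p-prime q-prime p≢q 1≤n p∣n (divides u refl) =
  *-monoˡ-≤ q (divisor≤ (1≤u u 1≤n) p∣u)
  where
  1≤u : ∀ u → 1 ≤ u * q → 1 ≤ u
  1≤u (suc _) _ = s≤s z≤n
  p∣u : p ∣ℕ u
  p∣u = distinct-prime-divisor p-prime q-prime p≢q (subst (p ∣ℕ_) (*-comm u q) p∣n)

quotient-unique : ∀ {p v w B s} .{{_ : NonZero p}} → v * p + B ≡ w * p + s → B < p → s < p → v ≡ w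
quotient-unique {p} {v} {w} {B} {s} eq B<p s<p = begin
  v                ≡⟨ quotient v B<p ⟨
  (v * p + B) / p  ≡⟨ cong (_/ p) eq ⟩
  (w * p + s) / p  ≡⟨ quotient w s<p ⟩
  w                ∎
  where
  open ≡-Reasoning
  quotient : ∀ u {r} → r < p → (u * p + r) / p ≡ u
  quotient u {r} r<p = begin
    (u * p + r) / p      ≡⟨ +-distrib-/-∣ˡ r (n∣m*n u) ⟩
    u * p / p + r / p    ≡⟨ cong₂ _+_ (m*n/n≡m u p) (m<n⇒m/n≡0 r<p) ⟩
    u + 0                ≡⟨ +-identityʳ u ⟩
    u                    ∎

multiple-below-double : ∀ {p n} → p ∣ℕ n → 1 ≤ n → n < p + p → n ≡ p
multiple-below-double (divides zero refl) ()
multiple-below-double {p} (divides 1 refl) _ _ = +-identityʳ p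
multiple-below-double {p} (divides (suc (suc w)) refl) _ n<2p =
  ⊥-elim (<⇒≱ n<2p (+-monoʳ-≤ p (m≤m+n p (w * p))))

-- Write d = (2 + e)·B.  The relation k(m + d) = (3 + e + k)·B with m, B ≥ 1 only has
-- solutions with k = 1 (then m = 2B) or k = 2, e = 0 (then B = 2m); in both cases m ∣ 2d.
balance⇒divides : ∀ k e m B → 1 ≤ m → 1 ≤ B →
  k * (m + (2 + e) * B) ≡ (3 + e + k) * B → m ∣ℕ 2 * ((2 + e) * B)
balance⇒divides zero e m (suc b) _ _ ()
balance⇒divides 1 e m B _ _ balance = divides (2 + e) (begin
  2 * ((2 + e) * B)  ≡⟨ double-as e B ⟩
  (2 + e) * (B + B)  ≡⟨ cong ((2 + e) *_) (sym m≡2B) ⟩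
  (2 + e) * m        ∎)
  where
  open ≡-Reasoning
  double-as : ∀ e B → 2 * ((2 + e) * B) ≡ (2 + e) * (B + B)
  double-as = solve-∀
  lhs : ∀ m e B → 1 * (m + (2 + e) * B) ≡ m + (2 + e) * B
  lhs = solve-∀
  rhs : ∀ e B → (3 + e + 1) * B ≡ (B + B) + (2 + e) * B
  rhs = solve-∀
  m≡2B : m ≡ B + B
  m≡2B = +-cancelʳ-≡ ((2 + e) * B) m (B + B) (trans (sym (lhs m e B)) (trans balance (rhs e B)))
balance⇒divides 2 zero m B _ _ balance = divides 8 (begin
  2 * (2 * B)        ≡⟨ cong (λ x → 2 * (2 * x)) B≡2m ⟩
  2 * (2 * (2 * m))  ≡⟨ octuple m ⟩
  8 * m              ∎)
  where
  open ≡-Reasoning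
  octuple : ∀ m → 2 * (2 * (2 * m)) ≡ 8 * m
  octuple = solve-∀
  lhs : ∀ m B → 2 * (m + 2 * B) ≡ 2 * m + 4 * B
  lhs = solve-∀
  rhs : ∀ B → 5 * B ≡ B + 4 * B
  rhs = solve-∀
  B≡2m : B ≡ 2 * m
  B≡2m = sym (+-cancelʳ-≡ (4 * B) (2 * m) B (trans (sym (lhs m B)) (trans balance (rhs B))))
balance⇒divides 2 (suc e) (suc m) B _ _ balance = ⊥-elim (m≢1+m+n R (trans (sym balance) (excess m e B)))
  where
  R : ℕ
  R = (3 + suc e + 2) * B
  excess : ∀ m e B → 2 * (suc m + (2 + suc e) * B) ≡ suc ((3 + suc e + 2) * B + (1 + 2 * m + e * B))
  excess = solve-∀
balance⇒divides (suc (suc (suc k))) e (suc m) B _ _ balance =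
  ⊥-elim (m≢1+m+n R (trans (sym balance) (excess k e m B)))
  where
  R : ℕ
  R = (3 + e + (3 + k)) * B
  excess : ∀ k e m B → (3 + k) * (suc m + (2 + e) * B)
           ≡ suc ((3 + e + (3 + k)) * B + (2 + 3 * m + k * suc m + 2 * e * B + k * B + k * e * B))
  excess = solve-∀

gap-divides-double : ∀ {A B d m} → 1 ≤ m → B ∣ℕ d → B < d → A ∣ℕ B + d → m + d ≡ A + B → m ∣ℕ 2 * d
gap-divides-double {B = zero} _ (divides e refl) B<d _ _ = ⊥-elim (<-irrefl (sym (*-zeroʳ e)) B<d)
gap-divides-double {B = suc b} _ (divides 0 refl) () _ _
gap-divides-double {B = suc b} _ (divides 1 refl) B<d _ _ = ⊥-elim (<-irrefl (sym (+-identityʳ (suc b))) B<d)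
gap-divides-double {A} {suc b} {m = m} 1≤m (divides (suc (suc e)) refl) _ (divides k B+d≡kA) m+d≡A+B =
  balance⇒divides k e m B 1≤m (s≤s z≤n) (begin
    k * (m + d)        ≡⟨ cong (k *_) m+d≡A+B ⟩
    k * (A + B)        ≡⟨ *-distribˡ-+ k A B ⟩
    k * A + k * B      ≡⟨ cong (_+ k * B) (sym B+d≡kA) ⟩
    B + d + k * B      ≡⟨ collect e k B ⟩
    (3 + e + k) * B    ∎)
  where
  open ≡-Reasoning
  B d : ℕ
  B = suc b
  d = (2 + e) * B
  collect : ∀ e k B → B + (2 + e) * B + k * B ≡ (3 + e + k) * B
  collect = solve-∀

distance : ∀ {m d n} → m + d ≡ n → ∣ + n - + m ∣ ≡ d
distance {m} {d} refl = cong ∣_∣ (begin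
  + (m + d) - + m      ≡⟨ cong (_- + m) (ℤP.pos-+ m d) ⟩
  + m ℤ.+ + d - + m    ≡⟨ cancel (+ m) (+ d) ⟩
  + d                  ∎)
  where
  open ≡-Reasoning
  cancel : ∀ a b → a ℤ.+ b - a ≡ b
  cancel = ℤSolver.solve-∀

distance-flip : ∀ {m d n} → m + d ≡ n → ∣ + m - + n ∣ ≡ d
distance-flip {m} {d} refl = begin
  ∣ + m - + (m + d) ∣           ≡⟨ cong ∣_∣ (cong (λ x → + m - x) (ℤP.pos-+ m d)) ⟩
  ∣ + m - (+ m ℤ.+ + d) ∣      ≡⟨ cong ∣_∣ (cancel (+ m) (+ d)) ⟩
  ∣ ℤ.- + d ∣                  ≡⟨ ℤP.∣-i∣≡∣i∣ (+ d) ⟩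
  d                            ∎
  where
  open ≡-Reasoning
  cancel : ∀ a b → a - (a ℤ.+ b) ≡ ℤ.- b
  cancel = ℤSolver.solve-∀

shifted-difference : ∀ {c d n} → c + d ≡ n → + n - + suc d ℤ.+ + 1 ≡ + c
shifted-difference {c} {d} refl = begin
  + (c + d) - (+ 1 ℤ.+ + d) ℤ.+ + 1  ≡⟨ cong (λ x → x - (+ 1 ℤ.+ + d) ℤ.+ + 1) (ℤP.pos-+ c d) ⟩
  + c ℤ.+ + d - (+ 1 ℤ.+ + d) ℤ.+ + 1  ≡⟨ cancel (+ c) (+ d) ⟩
  + c                                   ∎
  where
  open ≡-Reasoning
  cancel : ∀ x y → x ℤ.+ y - (+ 1 ℤ.+ y) ℤ.+ + 1 ≡ x
  cancel = ℤSolver.solve-∀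

-- For n = r + e we have n − β = e + (r − β); so the Korselt condition r − β ∣ n − β is
-- equivalent to |r − β| ∣ e, a divisibility between naturals.
cofactor-split : ∀ r e β → + (r + e) - β ≡ + e ℤ.+ (+ r - β)
cofactor-split r e β = trans (cong (_- β) (ℤP.pos-+ r e)) (rearrange (+ r) (+ e) β)
  where
  rearrange : ∀ a b c → a ℤ.+ b - c ≡ b ℤ.+ (a - c)
  rearrange = ℤSolver.solve-∀

korselt⇒cofactor : ∀ {r e n β} → r + e ≡ n → (+ r - β) ∣ (+ n - β) → ∣ + r - β ∣ ∣ℕ e
korselt⇒cofactor {r} {e} {β = β} refl r-β∣n-β =
  Signed.∣⇒∣ᵤ {i = + e}
    (Signed.∣m+n∣n⇒∣m (subst (Signed._∣_ (+ r - β)) (cofactor-split r e β) (Signed.∣ᵤ⇒∣ r-β∣n-β)) Signed.∣-refl)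

cofactor⇒korselt : ∀ {r e n β} → r + e ≡ n → ∣ + r - β ∣ ∣ℕ e → (+ r - β) ∣ (+ n - β)
cofactor⇒korselt {r} {e} {β = β} refl r-β∣e =
  Signed.∣⇒∣ᵤ (subst (Signed._∣_ (+ r - β)) (sym (cofactor-split r e β))
                     (Signed.∣m∣n⇒∣m+n (Signed.∣ᵤ⇒∣ {i = + e} r-β∣e) Signed.∣-refl))

semiprime-base : ∀ {p q β} → Prime p → Prime q → β ≢ 0ℤ → β ≢ + (p * q) →
  (+ p - β) ∣ (+ (p * q) - β) → (+ q - β) ∣ (+ (p * q) - β) → InZKS (p * q) β
semiprime-base {p} {q} {β} p-prime q-prime β≢0 β≢N at-p at-q =
  β≢0 , β≢N , 2≤pq , (λ N≡β → β≢N (sym N≡β)) , at-prime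
  where
  2≤pq : 2 ≤ p * q
  2≤pq = *-mono-≤ (prime≥2 p-prime) (≤-trans (s≤s z≤n) (prime≥2 q-prime))
  at-prime : ∀ r → Prime r → r ∣ℕ p * q → (+ r - β) ∣ (+ (p * q) - β)
  at-prime r r-prime r∣pq with prime-divisor-of-product p-prime q-prime r-prime r∣pq
  ... | inj₁ refl = at-p
  ... | inj₂ refl = at-q

module Setting (p-1 q-1 i s : ℕ) (p-prime : Prime (suc p-1)) (q-prime : Prime (suc q-1))
               (2p<q : 2 * suc p-1 < suc q-1) (q≡ip+s : suc q-1 ≡ i * suc p-1 + s)
               (1≤s : 1 ≤ s) (s<p : s < suc p-1) where

  open ≤-Reasoning

  p q N : ℕ
  p = suc p-1
  q = suc q-1
  N = p * q

  1≤p-1 : 1 ≤ p-1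
  1≤p-1 = s≤s⁻¹ (prime≥2 p-prime)

  wide : p + p-1 < q-1
  wide = begin-strict
    p + p-1   <⟨ +-monoʳ-< p ≤-refl ⟩
    p + p     ≡⟨ cong (λ x → p + x) (+-identityʳ p) ⟨
    2 * p     ≤⟨ s≤s⁻¹ 2p<q ⟩
    q-1       ∎

  p<q : p < q
  p<q = begin-strict p ≤⟨ m≤m+n p p-1 ⟩ p + p-1 <⟨ wide ⟩ q-1 <⟨ n<1+n q-1 ⟩ q ∎

  p≢q : p ≢ q
  p≢q = <⇒≢ p<q

  1≤q-1 : 1 ≤ q-1
  1≤q-1 = ≤-trans 1≤p-1 (≤-trans (m≤n+m p-1 p) (<⇒≤ wide))

  1≤q*p-1 : 1 ≤ q * p-1
  1≤q*p-1 = *-mono-≤ {1} {q} (s≤s z≤n) 1≤p-1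

  1≤p*q-1 : 1 ≤ p * q-1
  1≤p*q-1 = *-mono-≤ {1} {p} (s≤s z≤n) 1≤q-1

  at-p : ∀ {β} → InZKS N β → ∣ + p - β ∣ ∣ℕ p * q-1
  at-p {β} (_ , _ , _ , _ , korselt) =
    korselt⇒cofactor {r = p} {β = β} (sym (*-suc p q-1)) (korselt p p-prime (m∣m*n q))

  at-q : ∀ {β} → InZKS N β → ∣ + q - β ∣ ∣ℕ q * p-1
  at-q {β} (_ , _ , _ , _ , korselt) =
    subst (∣ + q - β ∣ ∣ℕ_) (*-comm p-1 q) (korselt⇒cofactor {r = q} {β = β} refl (korselt q q-prime (n∣m*n p)))

  small-divisor : ∀ {B} → 1 ≤ B → B < q → B ∣ℕ q * p-1 → B ∣ℕ p-1
  small-divisor 1≤B B<q = prime-free-divisor q-prime (λ q∣B → <⇒≱ B<q (divisor≤ 1≤B q∣B))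

  no-negative : ∀ c → p + suc c ∣ℕ p * q-1 → q + suc c ∣ℕ q * p-1 → ⊥
  no-negative c p+c∣ q+c∣ with q ∣? suc c
  ... | no q∤c = <⇒≱ p-1<q+c (divisor≤ 1≤p-1 (prime-free-divisor q-prime q∤q+c q+c∣))
    where
    q∤q+c : ¬ q ∣ℕ q + suc c
    q∤q+c q∣q+c = q∤c (∣m+n∣m⇒∣n q∣q+c ∣-refl)
    p-1<q+c : p-1 < q + suc c
    p-1<q+c = begin-strict p-1 <⟨ n<1+n p-1 ⟩ p ≤⟨ <⇒≤ p<q ⟩ q ≤⟨ m≤m+n q (suc c) ⟩ q + suc c ∎
  ... | yes q∣c with p ∣? suc c
  ...   | no p∤c = <⇒≱ q-1<p+c (divisor≤ 1≤q-1 (prime-free-divisor p-prime p∤p+c p+c∣))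
    where
    p∤p+c : ¬ p ∣ℕ p + suc c
    p∤p+c p∣p+c = p∤c (∣m+n∣m⇒∣n p∣p+c ∣-refl)
    q-1<p+c : q-1 < p + suc c
    q-1<p+c = begin-strict
      q-1 <⟨ n<1+n q-1 ⟩ q ≤⟨ divisor≤ (s≤s z≤n) q∣c ⟩ suc c ≤⟨ m≤n+m (suc c) p ⟩ p + suc c ∎
  ...   | yes p∣c = <⇒≱ (m<n+m (suc c) (s≤s z≤n)) (begin
    q + suc c   ≤⟨ divisor≤ 1≤q*p-1 q+c∣ ⟩
    q * p-1     ≤⟨ *-monoʳ-≤ q (n≤1+n p-1) ⟩
    q * p       ≡⟨ *-comm q p ⟩
    N           ≤⟨ common-multiple≥ p-prime q-prime p≢q (s≤s z≤n) p∣c q∣c ⟩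
    suc c       ∎)

  p-condition : ∀ {A b} → p + A ≡ b → InZKS N (+ b) → A ∣ℕ p * q-1
  p-condition p+A≡b b∈KS = subst (_∣ℕ p * q-1) (distance-flip p+A≡b) (at-p b∈KS)

  q-condition-below : ∀ {b B} → b + B ≡ q → InZKS N (+ b) → B ∣ℕ q * p-1
  q-condition-below b+B≡q b∈KS = subst (_∣ℕ q * p-1) (distance b+B≡q) (at-q b∈KS)

  q-condition-above : ∀ {b B} → q + B ≡ b → InZKS N (+ b) → B ∣ℕ q * p-1
  q-condition-above q+B≡b b∈KS = subst (_∣ℕ q * p-1) (distance-flip q+B≡b) (at-q b∈KS)

  not-q : InZKS N (+ q) → ⊥
  not-q q∈KS = 0∤positive 1≤q*p-1 (q-condition-below (+-identityʳ q) q∈KS)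

  -- A base 0 < b ≤ p fails: q − b would divide p − 1, forcing q < 2p.
  not-low : ∀ {b B} → 1 ≤ b → b ≤ p → b + B ≡ q → 1 ≤ B → InZKS N (+ b) → ⊥
  not-low {b} {B} 1≤b b≤p b+B≡q 1≤B b∈KS = <-irrefl refl (begin-strict
    q           ≡⟨ b+B≡q ⟨
    b + B       ≤⟨ +-mono-≤ b≤p B≤p-1 ⟩
    p + p-1     <⟨ wide ⟩
    q-1         <⟨ n<1+n q-1 ⟩
    q           ∎)
    where
    B<q : B < q
    B<q = ≤-trans (+-monoˡ-≤ B 1≤b) (≤-reflexive b+B≡q)
    B≤p-1 : B ≤ p-1
    B≤p-1 = divisor≤ 1≤p-1 (small-divisor 1≤B B<q (q-condition-below b+B≡q b∈KS))

  c₀ : ℤ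
  c₀ = + q - + p ℤ.+ + 1

  -- If q + 1 = 2p + m and m ∣ 2(p − 1), then q − p + 1 = p + m is a Korselt base of N:
  -- |p − c₀| = m divides q − 1 = m + 2(p − 1), and |q − c₀| = p − 1.
  c₀-Korselt : ∀ m → p + m + p-1 ≡ q → m ∣ℕ 2 * p-1 → InZKS N c₀
  c₀-Korselt m p+m+p-1≡q m∣2[p-1] = subst (InZKS N) (sym (shifted-difference p+m+p-1≡q)) base
    where
    c : ℕ
    c = p + m
    q-1≡ : q-1 ≡ m + 2 * p-1
    q-1≡ = trans (sym (suc-injective p+m+p-1≡q)) (rearrange p-1 m)
      where
      rearrange : ∀ p-1 m → p-1 + m + p-1 ≡ m + 2 * p-1
      rearrange = solve-∀
    m∣q-1 : m ∣ℕ q-1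
    m∣q-1 = subst (m ∣ℕ_) (sym q-1≡) (∣m∣n⇒∣m+n ∣-refl m∣2[p-1])
    c<N : c < N
    c<N = begin-strict c <⟨ m<m+n c 1≤p-1 ⟩ c + p-1 ≡⟨ p+m+p-1≡q ⟩ q ≤⟨ m≤m+n q (p-1 * q) ⟩ N ∎
    base : InZKS N (+ c)
    base = semiprime-base p-prime q-prime (λ ()) (λ c≡N → <-irrefl (ℤP.+-injective c≡N) c<N)
      (cofactor⇒korselt {r = p} {β = + c} (sym (*-suc p q-1))
        (subst (_∣ℕ p * q-1) (sym (distance-flip {p} {m} refl)) (∣-trans m∣q-1 (n∣m*n p))))
      (cofactor⇒korselt {r = q} {β = + c} refl
        (subst (_∣ℕ p-1 * q) (sym (distance {c} {p-1} p+m+p-1≡q)) (m∣m*n q)))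

  p-cofree : ∀ {A b} → p + A ≡ b → ¬ p ∣ℕ b → A ∣ℕ p * q-1 → A ∣ℕ q-1
  p-cofree p+A≡b p∤b =
    prime-free-divisor p-prime (λ p∣A → p∤b (subst (p ∣ℕ_) p+A≡b (∣m∣n⇒∣m+n ∣-refl p∣A)))

  q-cofree : ∀ {B b} → q + B ≡ b → ¬ q ∣ℕ b → B ∣ℕ q * p-1 → B ∣ℕ p-1
  q-cofree q+B≡b q∤b =
    prime-free-divisor q-prime (λ q∣B → q∤b (subst (q ∣ℕ_) q+B≡b (∣m∣n⇒∣m+n ∣-refl q∣B)))

  MiddleOutcome : ℕ → Set
  MiddleOutcome b = b ≡ i * p ⊎ b + p-1 ≡ q ⊎ ∃ λ m → p + m + p-1 ≡ q × m ∣ℕ 2 * p-1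

  -- A base p < b < q, with p + A = b and b + B = q: then B ∣ p − 1.  If p ∣ b, comparing
  -- q = b + B with q = ip + s gives b = ip.  Otherwise A ∣ q − 1, and either B = p − 1
  -- (so b = q − p + 1) or B is a proper divisor of p − 1 and gap-divides-double applies.
  middle : ∀ {b A B} → p + A ≡ b → b + B ≡ q → 1 ≤ B → InZKS N (+ b) → MiddleOutcome b
  middle {b} {A} {B} p+A≡b b+B≡q 1≤B b∈KS = by-cases (p ∣? b) (m≤n⇒m<n∨m≡n B≤p-1)
    where
    B∣p-1 : B ∣ℕ p-1
    B∣p-1 = small-divisor 1≤B B<q (q-condition-below b+B≡q b∈KS)
      where
      B<q : B < q
      B<q = ≤-trans (+-monoˡ-≤ B (subst (1 ≤_) p+A≡b (s≤s z≤n))) (≤-reflexive b+B≡q)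
    B≤p-1 : B ≤ p-1
    B≤p-1 = divisor≤ 1≤p-1 B∣p-1
    q-1≡ : p-1 + (A + B) ≡ q-1
    q-1≡ = suc-injective (trans (sym (+-assoc p A B)) (trans (cong (_+ B) p+A≡b) b+B≡q))
    by-cases : Dec (p ∣ℕ b) → B < p-1 ⊎ B ≡ p-1 → MiddleOutcome b
    by-cases (yes (divides v b≡vp)) _ = inj₁ (trans b≡vp (cong (_* p) v≡i))
      where
      v≡i : v ≡ i
      v≡i = quotient-unique (trans (cong (_+ B) (sym b≡vp)) (trans b+B≡q q≡ip+s)) (s≤s B≤p-1) s<p
    by-cases (no _) (inj₂ B≡p-1) = inj₂ (inj₁ (subst (λ x → b + x ≡ q) B≡p-1 b+B≡q))
    by-cases (no p∤b) (inj₁ B<p-1) =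
      inj₂ (inj₂ (suc m , p+m+p-1≡q , gap-divides-double (s≤s z≤n) B∣p-1 B<p-1 A∣B+p-1 m+p-1≡A+B))
      where
      A∣B+p-1 : A ∣ℕ B + p-1
      A∣B+p-1 = ∣m+n∣m⇒∣n (subst (A ∣ℕ_) (trans (sym q-1≡) (rotate p-1 A B))
                                     (p-cofree p+A≡b p∤b (p-condition p+A≡b b∈KS))) ∣-refl
        where
        rotate : ∀ p-1 A B → p-1 + (A + B) ≡ A + (B + p-1)
        rotate = solve-∀
      p-1<A+B : p-1 < A + B
      p-1<A+B = +-cancelˡ-< p-1 p-1 (A + B) (begin-strict
        p-1 + p-1     <⟨ +-monoˡ-< p-1 (n<1+n p-1) ⟩
        p + p-1       <⟨ wide ⟩
        q-1           ≡⟨ q-1≡ ⟨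
        p-1 + (A + B) ∎)
      m : ℕ
      m = proj₁ (gap p-1<A+B)
      m+p-1≡A+B : suc m + p-1 ≡ A + B
      m+p-1≡A+B = trans (+-comm (suc m) p-1) (proj₂ (gap p-1<A+B))
      p+m+p-1≡q : p + suc m + p-1 ≡ q
      p+m+p-1≡q = begin-equality
        p + suc m + p-1   ≡⟨ +-assoc p (suc m) p-1 ⟩
        p + (suc m + p-1) ≡⟨ cong (λ x → p + x) m+p-1≡A+B ⟩
        p + (A + B)       ≡⟨ +-assoc p A B ⟨
        p + A + B         ≡⟨ cong (_+ B) p+A≡b ⟩
        b + B             ≡⟨ b+B≡q ⟩
        q                 ∎

  -- A base q < b with B ∣ p − 1.  If p ∣ b then p ∣ s + B with 0 < s + B < 2p, so
  -- s + B = p and b = (i + 1)p.  Otherwise A ∣ q − 1; B = p − 1 gives b = p + q − 1, while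
  -- p − 1 = B + D with D ≥ 1 gives q − 1 = A + D with A ∣ D, hence q − 1 ≤ 2(p − 1).
  off-q : ∀ {b A B} → p + A ≡ b → q + B ≡ b → A ∣ℕ p * q-1 → B ∣ℕ p-1 → Dec (p ∣ℕ b) →
    b ≡ (i + 1) * p ⊎ b ≡ p-1 + q
  off-q {b} {A} {B} p+A≡b q+B≡b A∣ B∣p-1 (yes p∣b) = inj₁ (begin-equality
    b                ≡⟨ b≡ ⟩
    i * p + (s + B)  ≡⟨ cong (λ x → i * p + x) s+B≡p ⟩
    i * p + p        ≡⟨ next-multiple i p ⟩
    (i + 1) * p      ∎)
    where
    next-multiple : ∀ i p → i * p + p ≡ (i + 1) * p
    next-multiple = solve-∀
    b≡ : b ≡ i * p + (s + B)
    b≡ = trans (sym q+B≡b) (trans (cong (_+ B) q≡ip+s) (+-assoc (i * p) s B))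
    s+B≡p : s + B ≡ p
    s+B≡p = multiple-below-double (∣m+n∣m⇒∣n (subst (p ∣ℕ_) b≡ p∣b) (n∣m*n i)) (≤-trans 1≤s (m≤m+n s B))
              (+-mono-<-≤ s<p (≤-trans (divisor≤ 1≤p-1 B∣p-1) (n≤1+n p-1)))
  off-q {b} {A} {B} p+A≡b q+B≡b A∣ B∣p-1 (no p∤b) with m≤n⇒m<n∨m≡n (divisor≤ 1≤p-1 B∣p-1)
  ... | inj₂ B≡p-1 = inj₂ (trans (sym q+B≡b) (trans (cong (λ x → q + x) B≡p-1) (+-comm q p-1)))
  ... | inj₁ B<p-1 = ⊥-elim (<-irrefl refl (begin-strict
    q-1          ≡⟨ q-1≡A+D ⟩
    A + D        ≤⟨ +-monoˡ-≤ D (divisor≤ (s≤s z≤n) A∣D) ⟩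
    D + D        ≤⟨ +-mono-≤ D≤p-1 D≤p-1 ⟩
    p-1 + p-1    ≤⟨ +-monoˡ-≤ p-1 (n≤1+n p-1) ⟩
    p + p-1      <⟨ wide ⟩
    q-1          ∎))
    where
    D : ℕ
    D = suc (proj₁ (gap B<p-1))
    B+D≡p-1 : B + D ≡ p-1
    B+D≡p-1 = proj₂ (gap B<p-1)
    D≤p-1 : D ≤ p-1
    D≤p-1 = ≤-trans (m≤n+m D B) (≤-reflexive B+D≡p-1)
    q-1≡A+D : q-1 ≡ A + D
    q-1≡A+D = +-cancelʳ-≡ B q-1 (A + D) (begin-equality
      q-1 + B      ≡⟨ suc-injective (trans q+B≡b (sym p+A≡b)) ⟩
      p-1 + A      ≡⟨ cong (_+ A) B+D≡p-1 ⟨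
      B + D + A    ≡⟨ rotate B D A ⟩
      A + D + B    ∎)
      where
      rotate : ∀ B D A → B + D + A ≡ A + D + B
      rotate = solve-∀
    A∣D : A ∣ℕ D
    A∣D = ∣m+n∣m⇒∣n (subst (A ∣ℕ_) q-1≡A+D (p-cofree p+A≡b p∤b A∣)) ∣-refl

  -- If p and q both divide b then b ≥ N,
  -- while A ≤ p(q − 1) gives b ≤ N.  If only q divides b then B ≥ q and A ≤ q − 1 give
  -- b < 2q ≤ b.  Otherwise B ∣ p − 1 and off-q finishes.
  high : ∀ {b A B} → p + A ≡ b → q + B ≡ b → 1 ≤ B → b ≢ N → InZKS N (+ b) →
    b ≡ (i + 1) * p ⊎ b ≡ p-1 + q
  high {b} {A} {B} p+A≡b q+B≡b 1≤B b≢N b∈KS = by-cases (q ∣? b) (p ∣? b)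
    where
    A∣ : A ∣ℕ p * q-1
    A∣ = p-condition p+A≡b b∈KS
    by-cases : Dec (q ∣ℕ b) → Dec (p ∣ℕ b) → b ≡ (i + 1) * p ⊎ b ≡ p-1 + q
    by-cases (yes q∣b) (yes p∣b) =
      ⊥-elim (b≢N (≤-antisym b≤N (common-multiple≥ p-prime q-prime p≢q 1≤b p∣b q∣b)))
      where
      1≤b : 1 ≤ b
      1≤b = subst (1 ≤_) p+A≡b (s≤s z≤n)
      b≤N : b ≤ N
      b≤N = begin
        b             ≡⟨ p+A≡b ⟨
        p + A         ≤⟨ +-monoʳ-≤ p (divisor≤ 1≤p*q-1 A∣) ⟩
        p + p * q-1   ≡⟨ *-suc p q-1 ⟨
        N             ∎
    by-cases (yes q∣b) (no p∤b) = ⊥-elim (<-irrefl refl (begin-strict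
      b         ≡⟨ p+A≡b ⟨
      p + A     ≤⟨ +-monoʳ-≤ p (divisor≤ 1≤q-1 (p-cofree p+A≡b p∤b A∣)) ⟩
      p + q-1   <⟨ +-mono-<-≤ p<q (n≤1+n q-1) ⟩
      q + q     ≤⟨ +-monoʳ-≤ q (divisor≤ 1≤B q∣B) ⟩
      q + B     ≡⟨ q+B≡b ⟩
      b         ∎))
      where
      q∣B : q ∣ℕ B
      q∣B = ∣m+n∣m⇒∣n (subst (q ∣ℕ_) (sym q+B≡b) q∣b) ∣-refl
    by-cases (no q∤b) p∣b? =
      off-q p+A≡b q+B≡b A∣ (q-cofree q+B≡b q∤b (q-condition-above q+B≡b b∈KS)) p∣b?

  Admissible : ℤ → Set
  Admissible β = (β ≡ + (i * p)) ⊎ (β ≡ + ((i + 1) * p)) ⊎ (β ≡ + (p + q) - + 1)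

  classify : ¬ InZKS N c₀ → (β : ℤ) → InZKS N β → Admissible β
  classify _ -[1+ c ] β∈KS = ⊥-elim (no-negative c (at-p β∈KS) (at-q β∈KS))
  classify _ (+ zero) (β≢0 , _) = ⊥-elim (β≢0 refl)
  classify c₀∉KS (+ b@(suc _)) b∈KS@(_ , b≢N , _) with <-cmp b q
  ... | tri≈ _ refl _ = ⊥-elim (not-q b∈KS)
  ... | tri> _ _ q<b with gap q<b | gap (<-trans p<q q<b)
  ...   | _ , q+B≡b | _ , p+A≡b =
    inj₂ (map (cong (λ n → + n)) (cong (λ n → + n))
              (high p+A≡b q+B≡b (s≤s z≤n) (b≢N ∘ cong (λ n → + n)) b∈KS))
  classify c₀∉KS (+ b@(suc _)) b∈KS | tri< b<q _ _ with gap b<q | b ≤? p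
  ... | _ , b+B≡q | yes b≤p = ⊥-elim (not-low (s≤s z≤n) b≤p b+B≡q (s≤s z≤n) b∈KS)
  ... | _ , b+B≡q | no b≰p with gap (≰⇒> b≰p)
  ...   | _ , p+A≡b with middle p+A≡b b+B≡q (s≤s z≤n) b∈KS
  ...     | inj₁ b≡ip = inj₁ (cong (λ n → + n) b≡ip)
  ...     | inj₂ (inj₁ b+p-1≡q) = ⊥-elim (c₀∉KS (subst (InZKS N) (sym (shifted-difference b+p-1≡q)) b∈KS))
  ...     | inj₂ (inj₂ (m , p+m+p-1≡q , m∣2[p-1])) = ⊥-elim (c₀∉KS (c₀-Korselt m p+m+p-1≡q m∣2[p-1]))

corollary3p2 : (p q i s : ℕ) → Prime p → Prime q → p < q →
    q ≡ i * p + s → 1 ≤ s → s < p →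
    2 * p < q →
    ¬ InZKS (p * q) (+ q - + p Data.Integer.+ + 1) →
    (β : ℤ) → InZKS (p * q) β →
      (β ≡ + (i * p)) ⊎ (β ≡ + ((i + 1) * p)) ⊎ (β ≡ + (p + q) - + 1)
corollary3p2 zero _ _ _ p-prime = ⊥-elim (¬prime[0] p-prime)
corollary3p2 (suc _) zero _ _ _ q-prime = ⊥-elim (¬prime[0] q-prime)
corollary3p2 (suc p-1) (suc q-1) i s p-prime q-prime _ q≡ip+s 1≤s s<p 2p<q =
  Setting.classify p-1 q-1 i s p-prime q-prime 2p<q q≡ip+s 1≤s s<p
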